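{- Let $T$ be a decomposition tree and $v$ an internal node of $T$ labeled $\odot$, with left child $v_l$ and right child $v_r$. Then $\widehat{\min}(v)=\widehat{\min}(v_l)+\widehat{\min}(v_r)$.
   Context: All graphs are finite, simple and undirected. For a graph $H$ and $S\subseteq V(H)$, $N_H[S]$ is the closed neighbourhood of $S$ in $H$ and $H[S]$ the induced subgraph; a graph with no vertices is regarded as having a (empty) perfect matching. A decomposition tree is a rooted tree $T$ in which every internal node has exactly two children, a left child $v_l$ and a right child $v_r$, and carries one of the labels $\otimes$ (true twin), $\odot$ (false twin), $\oplus$ (attachment). To each node $v$ are associated a graph $\hat G(v)$ and a twin set $\hat{TS}(v)\subseteq V(\hat G(v))$: for a leaf, $\hat G(v)$ is a single vertex $x$ (distinct leaves giving distinct vertices) and $\hat{TS}(v)=\{x\}$; for an internal node $v$, $V(\hat G(v))=V(\hat G(v_l))\cup V(\hat G(v_r))$ and: if $v$ is labeled $\otimes$, $E(\hat G(v))=E(\hat G(v_l))\cup E(\hat G(v_r))\cup\{xy: x\in \hat{TS}(v_l), y\in\hat{TS}(v_r)\}$ and $\hat{TS}(v)=\hat{TS}(v_l)\cup\hat{TS}(v_r)$; if labeled $\odot$, $E(\hat G(v))=E(\hat G(v_l))\cup E(\hat G(v_r))$ and $\hat{TS}(v)=\hat{TS}(v_l)\cup\hat{TS}(v_r)$; if labeled $\oplus$, the edge set is as for $\otimes$ and $\hat{TS}(v)=\hat{TS}(v_l)$. For a node $u$ and $0\le k\le|\hat{TS}(u)|$, $\hat\gamma_k(u)$ is the minimum of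 $|S|$ over all $S\subseteq V(\hat G(u))$ with $V(\hat G(u))\setminus \hat{TS}(u)\subseteq N_{\hat G(u)}[S]$ for which there is $X\subseteq S\cap\hat{TS}(u)$, $|X|=k$, such that $\hat G(u)[S\setminus X]$ has a perfect matching. Let $\widehat{\min}(u)=\min\{\hat\gamma_k(u):0\le k\le|\hat{TS}(u)|\}$. -}

module Defs where

open import Data.Nat using (ℕ; _+_; _≤_)
open import Data.Bool using (Bool; true; false; if_then_else_)
open import Data.Unit using (⊤; tt)
open import Data.Empty using (⊥)
open import Data.Sum using (_⊎_; inj₁; inj₂; [_,_])
open import Data.Product using (Σ; ∃; _×_; _,_)
open import Relation.Binary.PropositionalEquality using (_≡_)

-- Node labels: ⊗ (true twin), ⊙ (false twin), ⊕ (attachment)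
data Label : Set where
  ⊗ ⊙ ⊕ : Label

-- Decomposition tree (a subtree rooted at a node v of T; every internal
-- node has exactly two children, left and right).
data DTree : Set where
  leaf : DTree
  node : Label → DTree → DTree → DTree

-- Vertices of Ĝ(v): the leaves of the subtree rooted at v
-- (distinct leaves give distinct vertices).
Vtx : DTree → Set
Vtx leaf = ⊤
Vtx (node _ l r) = Vtx l ⊎ Vtx r

TS : (t : DTree) → Vtx t → Bool
TS leaf _ = true
TS (node ⊗ l r) = [ TS l , TS r ]
TS (node ⊙ l r) = [ TS l , TS r ]
TS (node ⊕ l r) = [ TS l , (λ _ → false) ]

joins : Label → Set
joins ⊗ = ⊤
joins ⊙ = ⊥
joins ⊕ = ⊤

Adj : (t : DTree) → Vtx t → Vtx t → Set
Adj leaf _ _ = ⊥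
Adj (node a l r) (inj₁ x) (inj₁ y) = Adj l x y
Adj (node a l r) (inj₂ x) (inj₂ y) = Adj r x y
Adj (node a l r) (inj₁ x) (inj₂ y) = joins a × TS l x ≡ true × TS r y ≡ true
Adj (node a l r) (inj₂ x) (inj₁ y) = joins a × TS l y ≡ true × TS r x ≡ true

Subset : DTree → Set
Subset t = Vtx t → Bool

card : (t : DTree) → Subset t → ℕ
card leaf S = if S tt then 1 else 0
card (node _ l r) S = card l (λ x → S (inj₁ x)) + card r (λ x → S (inj₂ x))

InClosedNbhd : (t : DTree) → Subset t → Vtx t → Set
InClosedNbhd t S x = S x ≡ true ⊎ Σ (Vtx t) (λ y → S y ≡ true × Adj t y x)

-- Ĝ(v)[A] has a perfect matching: a partner function pairing every
-- vertex of A with an adjacent vertex of A, which is an involution on A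
-- (so the edges {x, m x}, x ∈ A, form a perfect matching of Ĝ(v)[A]).
HasPerfectMatching : (t : DTree) → Subset t → Set
HasPerfectMatching t A =
  Σ (Vtx t → Vtx t) λ m →
    (x : Vtx t) → A x ≡ true →
      A (m x) ≡ true × Adj t x (m x) × m (m x) ≡ x

Feasible : (t : DTree) → ℕ → Subset t → Set
Feasible t k S =
  ((x : Vtx t) → TS t x ≡ false → InClosedNbhd t S x) ×
  Σ (Subset t) λ X →
    ((x : Vtx t) → X x ≡ true → S x ≡ true × TS t x ≡ true) ×
    card t X ≡ k ×
    HasPerfectMatching t (λ x → if X x then false else S x)

-- IsMinHat t m : the value min̂(v) = min_{0 ≤ k ≤ |T̂S(v)|} γ̂_k(v) exists
-- (is finite) and equals m.
IsMinHat : DTree → ℕ → Set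
IsMinHat t m =
  (Σ ℕ λ k → k ≤ card t (TS t) × Σ (Subset t) λ S → Feasible t k S × card t S ≡ m) ×
  ((k : ℕ) → k ≤ card t (TS t) → (S : Subset t) → Feasible t k S → m ≤ card t S)

{-# OPTIONS --safe #-}
module Submission where

-- A ⊙ node adds no edges and its twin set is the disjoint union of the
-- twin sets of its children.  Hence a feasible set S of Ĝ(v), together
-- with its set X and the perfect matching of S ∖ X, is exactly a pair of
-- feasible sets of Ĝ(v_l) and Ĝ(v_r) (no matching edge can cross, since
-- no edge crosses), with k and |S| adding up.  Minimising the two
-- independent halves separately therefore minimises the whole.

open import Defs
open import Data.Nat using (ℕ; _+_; _≤_; z≤n)
open import Data.Nat.Properties using (≤-refl; +-mono-≤; +-cancelʳ-≤; +-cancelˡ-≤)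
open import Data.Bool using (true; false)
open import Data.Unit using (tt)
open import Data.Sum using (inj₁; inj₂; [_,_])
import Data.Sum as Sum
open import Data.Product using (Σ; _×_; _,_; proj₂)
open import Function using (_∘_; id; const)
open import Relation.Binary.PropositionalEquality using (_≡_; refl; cong; cong₂)
open import Function.Bundles using (_⇔_; mk⇔)

card-mono : (t : DTree) {A B : Subset t} →
            ((x : Vtx t) → A x ≡ true → B x ≡ true) → card t A ≤ card t B
card-mono leaf {A} A⊆B with A tt in eq
... | false = z≤n
... | true rewrite A⊆B tt eq = ≤-refl
card-mono (node _ l r) A⊆B =
  +-mono-≤ (card-mono l (A⊆B ∘ inj₁)) (card-mono r (A⊆B ∘ inj₂))

Feasible⇒≤card-TS : (t : DTree) {k : ℕ} {S : Subset t} →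
                    Feasible t k S → k ≤ card t (TS t)
Feasible⇒≤card-TS t (_ , X , X⊆S∩TS , refl , _) =
  card-mono t (λ x Xx → proj₂ (X⊆S∩TS x Xx))

Dominates : (t : DTree) → Subset t → Set
Dominates t S = (x : Vtx t) → TS t x ≡ false → InClosedNbhd t S x

module _ {a : Label} {l r : DTree} {S : Subset (node a l r)} where

  closedNbhd-inj₁ : {x : Vtx l} →
                    InClosedNbhd l (S ∘ inj₁) x → InClosedNbhd (node a l r) S (inj₁ x)
  closedNbhd-inj₁ (inj₁ Sx) = inj₁ Sx
  closedNbhd-inj₁ (inj₂ (y , Sy , yx)) = inj₂ (inj₁ y , Sy , yx)

  closedNbhd-inj₂ : {x : Vtx r} →
                    InClosedNbhd r (S ∘ inj₂) x → InClosedNbhd (node a l r) S (inj₂ x)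
  closedNbhd-inj₂ (inj₁ Sx) = inj₁ Sx
  closedNbhd-inj₂ (inj₂ (y , Sy , yx)) = inj₂ (inj₂ y , Sy , yx)

module _ {l r : DTree} where

  private
    N : DTree
    N = node ⊙ l r

  module _ {S : Subset N} where

    closedNbhd-⊙-inj₁⁻ : {x : Vtx l} →
                         InClosedNbhd N S (inj₁ x) → InClosedNbhd l (S ∘ inj₁) x
    closedNbhd-⊙-inj₁⁻ (inj₁ Sx) = inj₁ Sx
    closedNbhd-⊙-inj₁⁻ (inj₂ (inj₁ y , Sy , yx)) = inj₂ (y , Sy , yx)
    closedNbhd-⊙-inj₁⁻ (inj₂ (inj₂ y , _ , () , _))

    closedNbhd-⊙-inj₂⁻ : {x : Vtx r} →
                         InClosedNbhd N S (inj₂ x) → InClosedNbhd r (S ∘ inj₂) x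
    closedNbhd-⊙-inj₂⁻ (inj₁ Sx) = inj₁ Sx
    closedNbhd-⊙-inj₂⁻ (inj₂ (inj₂ y , Sy , yx)) = inj₂ (y , Sy , yx)
    closedNbhd-⊙-inj₂⁻ (inj₂ (inj₁ y , _ , () , _))

  dominates-⊙-join : {Sl : Subset l} {Sr : Subset r} →
                     Dominates l Sl → Dominates r Sr → Dominates N [ Sl , Sr ]
  dominates-⊙-join Dl Dr (inj₁ x) x∉TS = closedNbhd-inj₁ (Dl x x∉TS)
  dominates-⊙-join Dl Dr (inj₂ x) x∉TS = closedNbhd-inj₂ (Dr x x∉TS)

  dominates-⊙-split : {S : Subset N} →
                      Dominates N S → Dominates l (S ∘ inj₁) × Dominates r (S ∘ inj₂)
  dominates-⊙-split D = (λ x x∉TS → closedNbhd-⊙-inj₁⁻ (D (inj₁ x) x∉TS))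
                      , (λ x x∉TS → closedNbhd-⊙-inj₂⁻ (D (inj₂ x) x∉TS))

  perfectMatching-⊙-join : {A : Subset N} →
                           HasPerfectMatching l (A ∘ inj₁) → HasPerfectMatching r (A ∘ inj₂) →
                           HasPerfectMatching N A
  perfectMatching-⊙-join {A} (ml , Pl) (mr , Pr) = m , P
    where
    m : Vtx N → Vtx N
    m = Sum.map ml mr
    P : (x : Vtx N) → A x ≡ true → A (m x) ≡ true × Adj N x (m x) × m (m x) ≡ x
    P (inj₁ x) Ax with Pl x Ax
    ... | Amx , x~mx , mmx = Amx , x~mx , cong inj₁ mmx
    P (inj₂ x) Ax with Pr x Ax
    ... | Amx , x~mx , mmx = Amx , x~mx , cong inj₂ mmx

  -- The partner of a left vertex is a left vertex, as no edge crosses;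
  -- the default branch of the case split is therefore never taken.
  perfectMatching-⊙-inj₁⁻ : {A : Subset N} →
                            HasPerfectMatching N A → HasPerfectMatching l (A ∘ inj₁)
  perfectMatching-⊙-inj₁⁻ {A} (m , P) = ml , Pl
    where
    ml : Vtx l → Vtx l
    ml x = [ id , const x ] (m (inj₁ x))
    Pl : (x : Vtx l) → A (inj₁ x) ≡ true →
         A (inj₁ (ml x)) ≡ true × Adj l x (ml x) × ml (ml x) ≡ x
    Pl x Ax with m (inj₁ x) | P (inj₁ x) Ax
    ... | inj₁ y | Ay , x~y , mmx rewrite mmx = Ay , x~y , refl
    ... | inj₂ y | _ , (() , _) , _

  perfectMatching-⊙-inj₂⁻ : {A : Subset N} →
                            HasPerfectMatching N A → HasPerfectMatching r (A ∘ inj₂)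
  perfectMatching-⊙-inj₂⁻ {A} (m , P) = mr , Pr
    where
    mr : Vtx r → Vtx r
    mr x = [ const x , id ] (m (inj₂ x))
    Pr : (x : Vtx r) → A (inj₂ x) ≡ true →
         A (inj₂ (mr x)) ≡ true × Adj r x (mr x) × mr (mr x) ≡ x
    Pr x Ax with m (inj₂ x) | P (inj₂ x) Ax
    ... | inj₂ y | Ay , x~y , mmx rewrite mmx = Ay , x~y , refl
    ... | inj₁ y | _ , (() , _) , _

  feasible-⊙-join : {k₁ k₂ : ℕ} {Sl : Subset l} {Sr : Subset r} →
                    Feasible l k₁ Sl → Feasible r k₂ Sr → Feasible N (k₁ + k₂) [ Sl , Sr ]
  feasible-⊙-join (Dl , Xl , Xl⊆ , refl , PMl) (Dr , Xr , Xr⊆ , refl , PMr) =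
    dominates-⊙-join Dl Dr , [ Xl , Xr ] , [ Xl⊆ , Xr⊆ ] , refl ,
    perfectMatching-⊙-join PMl PMr

  feasible-⊙-split : {k : ℕ} {S : Subset N} → Feasible N k S →
                     Σ ℕ λ k₁ → Σ ℕ λ k₂ →
                       Feasible l k₁ (S ∘ inj₁) × Feasible r k₂ (S ∘ inj₂) × k ≡ k₁ + k₂
  feasible-⊙-split (D , X , X⊆ , refl , PM) =
    let Dl , Dr = dominates-⊙-split D in
    _ , _ , (Dl , X ∘ inj₁ , X⊆ ∘ inj₁ , refl , perfectMatching-⊙-inj₁⁻ PM)
          , (Dr , X ∘ inj₂ , X⊆ ∘ inj₂ , refl , perfectMatching-⊙-inj₂⁻ PM) , refl

isMinHat-intro : (t : DTree) {m : ℕ} →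
                 (Σ ℕ λ k → Σ (Subset t) λ S → Feasible t k S × card t S ≡ m) →
                 ((k : ℕ) (S : Subset t) → Feasible t k S → m ≤ card t S) →
                 IsMinHat t m
isMinHat-intro t (k , S , F , |S|≡m) lower =
  (k , Feasible⇒≤card-TS t F , S , F , |S|≡m) , λ k _ → lower k

module _ {l r : DTree} where

  isMinHat-⊙-join : {m₁ m₂ : ℕ} → IsMinHat l m₁ → IsMinHat r m₂ →
                    IsMinHat (node ⊙ l r) (m₁ + m₂)
  isMinHat-⊙-join {m₁} {m₂} ((k₁ , _ , Sl , Fl , |Sl|≡m₁) , lowerˡ) ((k₂ , _ , Sr , Fr , |Sr|≡m₂) , lowerʳ) =
    isMinHat-intro (node ⊙ l r)
      (k₁ + k₂ , [ Sl , Sr ] , feasible-⊙-join Fl Fr , cong₂ _+_ |Sl|≡m₁ |Sr|≡m₂)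
      lower
    where
    lower : (k : ℕ) (S : Subset (node ⊙ l r)) → Feasible (node ⊙ l r) k S →
            m₁ + m₂ ≤ card (node ⊙ l r) S
    lower k S F with feasible-⊙-split F
    ... | k₁′ , k₂′ , Fl′ , Fr′ , _ =
      +-mono-≤ (lowerˡ k₁′ (Feasible⇒≤card-TS l Fl′) _ Fl′)
               (lowerʳ k₂′ (Feasible⇒≤card-TS r Fr′) _ Fr′)

  -- Each half of an optimal S is optimal: replacing it by a cheaper
  -- feasible set of the same child would give a cheaper feasible set of Ĝ(v).
  isMinHat-⊙-split : {m : ℕ} → IsMinHat (node ⊙ l r) m →
                     Σ ℕ λ m₁ → Σ ℕ λ m₂ → IsMinHat l m₁ × IsMinHat r m₂ × m ≡ m₁ + m₂
  isMinHat-⊙-split ((k , _ , S , F , refl) , lower) with feasible-⊙-split F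
  ... | k₁ , k₂ , Fl , Fr , _ =
    card l Sl , card r Sr ,
    isMinHat-intro l (k₁ , Sl , Fl , refl)
      (λ k′ Sl′ Fl′ → +-cancelʳ-≤ (card r Sr) _ _ (lower′ (feasible-⊙-join Fl′ Fr))) ,
    isMinHat-intro r (k₂ , Sr , Fr , refl)
      (λ k′ Sr′ Fr′ → +-cancelˡ-≤ (card l Sl) _ _ (lower′ (feasible-⊙-join Fl Fr′))) ,
    refl
    where
    Sl = S ∘ inj₁
    Sr = S ∘ inj₂
    lower′ : {k′ : ℕ} {S′ : Subset (node ⊙ l r)} → Feasible (node ⊙ l r) k′ S′ →
             card (node ⊙ l r) S ≤ card (node ⊙ l r) S′
    lower′ F′ = lower _ (Feasible⇒≤card-TS (node ⊙ l r) F′) _ F′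

lemma17 : (l r : DTree) (m : ℕ) →
    IsMinHat (node ⊙ l r) m ⇔
      Σ ℕ (λ m₁ → Σ ℕ (λ m₂ → IsMinHat l m₁ × IsMinHat r m₂ × m ≡ m₁ + m₂))
lemma17 l r m = mk⇔ isMinHat-⊙-split join
  where
  join : Σ ℕ (λ m₁ → Σ ℕ (λ m₂ → IsMinHat l m₁ × IsMinHat r m₂ × m ≡ m₁ + m₂)) →
         IsMinHat (node ⊙ l r) m
  join (_ , _ , minˡ , minʳ , refl) = isMinHat-⊙-join minˡ minʳ
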